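{- There exists an incomplete Robinsonian symmetric matrix which is not Strong-Robinsonian.
   Context: An $n\times n$ symmetric matrix $A=(a_{i,j})$ with real entries is \emph{incomplete} if some entries are missing, written $a_{i,j}=*$ (placed symmetrically). $A$ is \emph{Robinson} if (i) $a_{i,j}\le a_{i,k}$ for all $i\le k\le j$ with $a_{i,j}\ne *\ne a_{i,k}$, and (ii) $a_{i,j}\le a_{l,j}$ for all $i\le l\le j$ with $a_{i,j}\ne*\ne a_{l,j}$. $A$ is \emph{Strong-Robinson} if $a_{i,j}\le a_{k,l}$ for all $i\le k\le l\le j$ with $a_{i,j}\ne *\ne a_{k,l}$. For a permutation $\pi$ of $\{1,\dots,n\}$ let $A_\pi$ have entries $a_{\pi(i),\pi(j)}$. $A$ is \emph{Robinsonian} (resp. \emph{Strong-Robinsonian}) if there is a permutation $\pi$ such that $A_\pi$ is Robinson (resp. Strong-Robinson). -}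

module Defs where

open import Data.Nat using (ℕ)
open import Data.Fin using (Fin; _≤_)
open import Data.Fin.Permutation using (Permutation′; _⟨$⟩ʳ_)
open import Data.Maybe using (Maybe; just; nothing)
open import Data.Rational using (ℚ) renaming (_≤_ to _≤ℚ_)
open import Data.Product using (Σ; _×_; ∃)
open import Relation.Binary.PropositionalEquality using (_≡_)
open import Relation.Nullary using (¬_)

-- An incomplete matrix: an entry is either a (rational) value `just x`
-- or missing `nothing` (written * in the paper).
IMatrix : ℕ → Set
IMatrix n = Fin n → Fin n → Maybe ℚ

Symmetric : ∀ {n} → IMatrix n → Set
Symmetric {n} A = ∀ (i j : Fin n) → A i j ≡ A j i

Robinson : ∀ {n} → IMatrix n → Set
Robinson {n} A =
  (∀ (i j k : Fin n) (x y : ℚ) → i ≤ k → k ≤ j →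
     A i j ≡ just x → A i k ≡ just y → x ≤ℚ y)
  × (∀ (i j l : Fin n) (x y : ℚ) → i ≤ l → l ≤ j →
     A i j ≡ just x → A l j ≡ just y → x ≤ℚ y)

StrongRobinson : ∀ {n} → IMatrix n → Set
StrongRobinson {n} A =
  ∀ (i j k l : Fin n) (x y : ℚ) → i ≤ k → k ≤ l → l ≤ j →
    A i j ≡ just x → A k l ≡ just y → x ≤ℚ y

permute : ∀ {n} → Permutation′ n → IMatrix n → IMatrix n
permute π A i j = A (π ⟨$⟩ʳ i) (π ⟨$⟩ʳ j)

Robinsonian : ∀ {n} → IMatrix n → Set
Robinsonian {n} A = ∃ λ (π : Permutation′ n) → Robinson (permute π A)

StrongRobinsonian : ∀ {n} → IMatrix n → Set
StrongRobinsonian {n} A = ∃ λ (π : Permutation′ n) → StrongRobinson (permute π A)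

Incomplete : ∀ {n} → IMatrix n → Set
Incomplete {n} A = Σ (Fin n) λ i → Σ (Fin n) λ j → A i j ≡ nothing

-- For Strong-Robinson, the only 0 entry a₁₃ may not be
-- enclosed by any other entry, which forces 2 strictly between 1 and 3; orienting the line so
-- that 1 comes first, the entries ½ = a₂₄ = a₀₂ = a₀₁ < 1 = a₁₂ = a₂₃ = a₃₄ then force the order
-- 0 ≤ 1 ≤ 2 ≤ 3 ≤ 4, where a₀₄ = ½ encloses a₁₃ = 0.  The argument only needs the positions
-- to lie in a total preorder, and reversing that preorder supplies the other orientation.
module Submission where

open import Defs
open import Level using (Level)
open import Data.Nat using (ℕ)
import Data.Nat.Properties as ℕ
import Data.Fin as Fin
open import Data.Fin using (Fin; toℕ; _≤?_) renaming (_≤_ to _≤ᶠ_)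
open import Data.Fin.Properties using (all?)
import Data.Fin.Permutation as Permutation
open import Data.Fin.Permutation using (Permutation′; _⟨$⟩ˡ_; inverseʳ)
open import Data.Maybe using (Maybe; just; nothing)
open import Data.Maybe.Properties using (≡-dec)
open import Data.Rational using (ℚ; 0ℚ; ½; 1ℚ; _<_) renaming (_≤_ to _≤ℚ_)
open import Data.Rational.Properties using (<-irrefl; <-≤-trans; _<?_; _≟_) renaming (_≤?_ to _≤ℚ?_)
open import Data.Product using (Σ; _×_; _,_)
open import Data.Sum using (inj₁; inj₂)
open import Data.Unit using (⊤; tt)
open import Data.Empty using (⊥; ⊥-elim)
open import Relation.Binary.Bundles using (TotalPreorder)
import Relation.Binary.Construct.Flip.EqAndOrd as Flip
open import Relation.Nullary using (¬_; Dec; yes)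
open import Relation.Nullary.Decidable using (from-yes; _→-dec_)
open import Relation.Binary.PropositionalEquality using (_≡_; refl; subst₂; sym; trans)

private variable
  n : ℕ

_≤ᴹ_ : Maybe ℚ → Maybe ℚ → Set
just x ≤ᴹ just y = x ≤ℚ y
_      ≤ᴹ _      = ⊤

_≤ᴹ?_ : ∀ m m′ → Dec (m ≤ᴹ m′)
just x  ≤ᴹ? just y  = x ≤ℚ? y
just _  ≤ᴹ? nothing = yes tt
nothing ≤ᴹ? just _  = yes tt
nothing ≤ᴹ? nothing = yes tt

≤ᴹ⇒≤ : ∀ {m m′ x y} → m ≤ᴹ m′ → m ≡ just x → m′ ≡ just y → x ≤ℚ y
≤ᴹ⇒≤ x≤y refl refl = x≤y

RowsIncreaseInward ColumnsIncreaseInward : IMatrix n → Set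
RowsIncreaseInward A    = ∀ i j k → i ≤ᶠ k → k ≤ᶠ j → A i j ≤ᴹ A i k
ColumnsIncreaseInward A = ∀ i j l → i ≤ᶠ l → l ≤ᶠ j → A i j ≤ᴹ A l j

rowsIncreaseInward? : (A : IMatrix n) → Dec (RowsIncreaseInward A)
rowsIncreaseInward? A =
  all? λ i → all? λ j → all? λ k → i ≤? k →-dec (k ≤? j →-dec A i j ≤ᴹ? A i k)

columnsIncreaseInward? : (A : IMatrix n) → Dec (ColumnsIncreaseInward A)
columnsIncreaseInward? A =
  all? λ i → all? λ j → all? λ l → i ≤? l →-dec (l ≤? j →-dec A i j ≤ᴹ? A l j)

robinson-inward : {A : IMatrix n} →
  RowsIncreaseInward A → ColumnsIncreaseInward A → Robinson A
robinson-inward rows columns =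
    (λ i j k x y i≤k k≤j → ≤ᴹ⇒≤ (rows i j k i≤k k≤j))
  , (λ i j l x y i≤l l≤j → ≤ᴹ⇒≤ (columns i j l i≤l l≤j))

symmetric? : (A : IMatrix n) → Dec (Symmetric A)
symmetric? A = all? λ i → all? λ j → ≡-dec _≟_ (A i j) (A j i)

-- p puts the indices on a line, possibly with ties; StrongRobinson (permute π A) is the case
-- where p is π⁻¹ read in ℕ (see strongRobinson⇒along).
module _ {c ℓ₁ ℓ₂ : Level} (O : TotalPreorder c ℓ₁ ℓ₂) where
  open TotalPreorder O using (Carrier; _≲_)

  StrongRobinsonAlong : (Fin n → Carrier) → IMatrix n → Set ℓ₂
  StrongRobinsonAlong p A = ∀ u v x y s t → p u ≲ p x → p x ≲ p y → p y ≲ p v →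
    A u v ≡ just s → A x y ≡ just t → s ≤ℚ t

strongRobinsonAlong-flip : ∀ {c ℓ₁ ℓ₂} {O : TotalPreorder c ℓ₁ ℓ₂} {p} {A : IMatrix n} →
  Symmetric A → StrongRobinsonAlong O p A → StrongRobinsonAlong (Flip.totalPreorder O) p A
strongRobinsonAlong-flip symmetric sr u v x y s t x≳u y≳x v≳y uv≡s xy≡t =
  sr v u y x s t v≳y y≳x x≳u (trans (symmetric v u) uv≡s) (trans (symmetric y x) xy≡t)

strongRobinson⇒along : (π : Permutation′ n) {A : IMatrix n} → StrongRobinson (permute π A) →
  StrongRobinsonAlong ℕ.≤-totalPreorder (λ u → toℕ (π ⟨$⟩ˡ u)) A
strongRobinson⇒along π {A} sr u v x y s t u≤x x≤y y≤v uv≡s xy≡t =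
  sr _ _ _ _ s t u≤x x≤y y≤v (unpermute uv≡s) (unpermute xy≡t)
  where
  unpermute : ∀ {i j r} → A i j ≡ just r → permute π A (π ⟨$⟩ˡ i) (π ⟨$⟩ˡ j) ≡ just r
  unpermute {r = r} = subst₂ (λ a b → A a b ≡ just r) (sym (inverseʳ π)) (sym (inverseʳ π))

pattern 0F = Fin.zero
pattern 1F = Fin.suc 0F
pattern 2F = Fin.suc 1F
pattern 3F = Fin.suc 2F
pattern 4F = Fin.suc 3F

example : IMatrix 5
example 0F 1F = just ½
example 0F 2F = just ½
example 0F 4F = just ½
example 1F 0F = just ½
example 1F 2F = just 1ℚ
example 1F 3F = just 0ℚ
example 2F 0F = just ½
example 2F 1F = just 1ℚ
example 2F 3F = just 1ℚ
example 2F 4F = just ½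
example 3F 1F = just 0ℚ
example 3F 2F = just 1ℚ
example 3F 4F = just 1ℚ
example 4F 0F = just ½
example 4F 2F = just ½
example 4F 3F = just 1ℚ
example _  _  = nothing

example-symmetric : Symmetric example
example-symmetric = from-yes (symmetric? example)

example-robinson : Robinson example
example-robinson = robinson-inward
  (from-yes (rowsIncreaseInward? example)) (from-yes (columnsIncreaseInward? example))

0<½ : 0ℚ < ½
0<½ = from-yes (0ℚ <? ½)

0<1 : 0ℚ < 1ℚ
0<1 = from-yes (0ℚ <? 1ℚ)

½<1 : ½ < 1ℚ
½<1 = from-yes (½ <? 1ℚ)

module _ {c ℓ₁ ℓ₂ : Level} (O : TotalPreorder c ℓ₁ ℓ₂) {p : Fin 5 → TotalPreorder.Carrier O}
         (sr : StrongRobinsonAlong O p example) where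
  open TotalPreorder O using (_≲_; total) renaming (refl to ≲-refl; trans to ≲-trans)

  private
    enclosing-smaller : ∀ u v x y {s t} → example u v ≡ just s → example x y ≡ just t → t < s →
      p u ≲ p x → p x ≲ p y → p y ≲ p v → ⊥
    enclosing-smaller u v x y uv≡s xy≡t t<s u≲x x≲y y≲v =
      <-irrefl refl (<-≤-trans t<s (sr u v x y _ _ u≲x x≲y y≲v uv≡s xy≡t))

    2-between : p 1F ≲ p 3F → p 1F ≲ p 2F × p 2F ≲ p 3F
    2-between 1≲3 with total (p 1F) (p 2F) | total (p 2F) (p 3F)
    ... | inj₁ 1≲2 | inj₁ 2≲3 = 1≲2 , 2≲3
    ... | inj₂ 2≲1 | _        =
      ⊥-elim (enclosing-smaller 2F 3F 1F 3F refl refl 0<1 2≲1 1≲3 ≲-refl)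
    ... | inj₁ _   | inj₂ 3≲2 =
      ⊥-elim (enclosing-smaller 1F 2F 1F 3F refl refl 0<1 ≲-refl 1≲3 3≲2)

    4-after : p 1F ≲ p 2F → p 2F ≲ p 3F → p 3F ≲ p 4F
    4-after 1≲2 2≲3 with total (p 1F) (p 4F) | total (p 2F) (p 4F) | total (p 3F) (p 4F)
    ... | _        | _        | inj₁ 3≲4 = 3≲4
    ... | inj₂ 4≲1 | _        | _        =
      ⊥-elim (enclosing-smaller 4F 3F 1F 3F refl refl 0<1 4≲1 (≲-trans 1≲2 2≲3) ≲-refl)
    ... | inj₁ 1≲4 | inj₂ 4≲2 | _        =
      ⊥-elim (enclosing-smaller 1F 2F 4F 2F refl refl ½<1 1≲4 4≲2 ≲-refl)
    ... | _        | inj₁ 2≲4 | inj₂ 4≲3 =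
      ⊥-elim (enclosing-smaller 2F 3F 2F 4F refl refl ½<1 ≲-refl 2≲4 4≲3)

    0-before : p 1F ≲ p 2F → p 2F ≲ p 3F → p 0F ≲ p 1F
    0-before 1≲2 2≲3 with total (p 0F) (p 1F) | total (p 0F) (p 2F) | total (p 0F) (p 3F)
    ... | inj₁ 0≲1 | _        | _        = 0≲1
    ... | inj₂ 1≲0 | inj₁ 0≲2 | _        =
      ⊥-elim (enclosing-smaller 1F 2F 1F 0F refl refl ½<1 ≲-refl 1≲0 0≲2)
    ... | _        | inj₂ 2≲0 | inj₁ 0≲3 =
      ⊥-elim (enclosing-smaller 2F 3F 2F 0F refl refl ½<1 ≲-refl 2≲0 0≲3)
    ... | _        | _        | inj₂ 3≲0 =
      ⊥-elim (enclosing-smaller 1F 0F 1F 3F refl refl 0<½ ≲-refl (≲-trans 1≲2 2≲3) 3≲0)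

  example-1≰3-along : ¬ p 1F ≲ p 3F
  example-1≰3-along 1≲3 with 2-between 1≲3
  ... | 1≲2 , 2≲3 =
    enclosing-smaller 0F 4F 1F 3F refl refl 0<½ (0-before 1≲2 2≲3) 1≲3 (4-after 1≲2 2≲3)

example-not-strongRobinsonAlong : ∀ {c ℓ₁ ℓ₂} (O : TotalPreorder c ℓ₁ ℓ₂) {p} →
  ¬ StrongRobinsonAlong O p example
example-not-strongRobinsonAlong O {p} sr with TotalPreorder.total O (p 1F) (p 3F)
... | inj₁ 1≲3 = example-1≰3-along O sr 1≲3
... | inj₂ 3≲1 = example-1≰3-along (Flip.totalPreorder O)
  (strongRobinsonAlong-flip {O = O} {p} example-symmetric sr) 3≲1

lemma3 : Σ ℕ λ n → Σ (IMatrix n) λ A →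
    Symmetric A × Incomplete A × Robinsonian A × ¬ StrongRobinsonian A
lemma3 =
  5 , example , example-symmetric , (0F , 0F , refl) , (Permutation.id , example-robinson) ,
  λ (π , sr) → example-not-strongRobinsonAlong ℕ.≤-totalPreorder (strongRobinson⇒along π sr)
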